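{- For every Kripke model $\mathcal K=(W,\sqsubset,V)$ there is a provability model $\mathcal P=(W,\sqsubset,\{L_w\}_{w\in W^\sqsubset},V)$ (with the same frame and valuation) such that for every formula $A\in\mathcal L_\Box$ and every $w\in W$, $$\mathcal K,w\models A\iff \mathcal P,w\Vdash A.$$ Moreover, if $\sqsubset$ is transitive, then $\mathcal P$ can be chosen to have necessitation.
   Context: Language $\mathcal L_\Box$: formulas built from atomic propositions and $\bot$ using $\to$ and a unary modal operator $\Box$; other Boolean connectives are defined classically. A Kripke model $\mathcal K=(W,\sqsubset,V)$ has $W$ nonempty, $\sqsubset$ a binary relation on $W$, $V\subseteq W\times\mathrm{atoms}$, with the usual semantics ($\mathcal K,w\models\Box A$ iff $\mathcal K,u\models A$ for all $u$ with $w\sqsubset u$). A formula is purely modal if it is a Boolean combination of formulas of the form $\Box B$. A theory is a pair consisting of a set of axioms and a set of inference rules (finitely many premises, one conclusion); $\mathsf T\vdash A$ means $A$ is the last element of a finite sequence each element of which is an axiom or follows from earlier elements by a rule. A theory is classical if modus ponens is one of its rules and all classical tautologies are derivable. A provability pre-model is $\mathcal P=(W,\sqsubset,\{L_w\}_{w\in W^\sqsubset},V)$ where $(W,\sqsubset,V)$ is a Kripke model, $W^\sqsubset=\{u\in W:\exists v\,(v\sqsubset u)\}$, and each $L_w$ ($w\in W^\sqsubset$) is a theory. Satisfaction $\Vdash$: atoms as given by $V$, $\bot$ never holds, $\to$ classically, and $\mathcal P,w\Vdash\Box A$ iff $L_u\vdash A$ for all $u$ with $w\sqsubset u$. With $\sqsubset^+$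 the transitive closure of $\sqsubset$, $\mathcal P,w\Vdash^+A$ iff there is $u\sqsubset w$ such that $\mathcal P,v\Vdash A$ for all $v$ with $u\sqsubset^+v$. A provability model is a pre-model in which every $L_w$ is classical and which satisfies modal completeness: for every $w\in W^\sqsubset$ and every purely modal $A$, if $\mathcal P,w\Vdash^+A$ then $L_w\vdash A$. A provability model has necessitation if every $L_w$ has the rule "from $A$ infer $\Box A$" among its rules. -}

module Defs where

open import Data.Nat using (ℕ)
open import Data.Bool using (Bool; true; false; _∧_; not; _∨_)
open import Data.List using (List; []; _∷_)
open import Data.List.Relation.Unary.All using (All)
open import Data.Product using (Σ; ∃; _×_; _,_)
open import Data.Empty using (⊥)
open import Relation.Binary.PropositionalEquality using (_≡_)
open import Relation.Binary.Construct.Closure.Transitive using (TransClosure)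
open import Function.Bundles using (_⇔_)

infixr 5 _⇒_
data Formula : Set where
  atom : ℕ → Formula
  ⊥'   : Formula
  _⇒_  : Formula → Formula → Formula
  □    : Formula → Formula

data PurelyModal : Formula → Set where
  pm-□ : ∀ B → PurelyModal (□ B)
  pm-⊥ : PurelyModal ⊥'
  pm-⇒ : ∀ {A B} → PurelyModal A → PurelyModal B → PurelyModal (A ⇒ B)

-- Classical tautologies: true under every Boolean assignment to the
-- atoms and to the boxed formulas (treated as propositional variables).

evalB : (ℕ → Bool) → (Formula → Bool) → Formula → Bool
evalB f g (atom p) = f p
evalB f g ⊥'       = false
evalB f g (A ⇒ B)  = not (evalB f g A) ∨ evalB f g B
evalB f g (□ B)    = g B

Tautology : Formula → Set
Tautology A = ∀ (f : ℕ → Bool) (g : Formula → Bool) → evalB f g A ≡ true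

record Kripke : Set₁ where
  field
    W   : Set
    _⊏_ : W → W → Set
    V   : W → ℕ → Set

module _ (K : Kripke) where
  open Kripke K

  _,_⊨_ : W → Formula → Set
  _,_⊨_ w (atom p) = V w p
  _,_⊨_ w ⊥'       = ⊥
  _,_⊨_ w (A ⇒ B)  = _,_⊨_ w A → _,_⊨_ w B
  _,_⊨_ w (□ A)    = ∀ u → w ⊏ u → _,_⊨_ u A

record Theory : Set₁ where
  field
    Ax   : Formula → Set
    Rule : List Formula → Formula → Set

-- derivability (derivation trees, equivalent to finite sequences)
data _⊢_ (T : Theory) : Formula → Set where
  ax   : ∀ {A} → Theory.Ax T A → T ⊢ A
  rule : ∀ {ps A} → Theory.Rule T ps A → All (T ⊢_) ps → T ⊢ A

Classical : Theory → Set
Classical T =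
  (∀ A B → Theory.Rule T (A ∷ (A ⇒ B) ∷ []) B) ×
  (∀ A → Tautology A → T ⊢ A)

HasNecRule : Theory → Set
HasNecRule T = ∀ A → Theory.Rule T (A ∷ []) (□ A)

-- Provability pre-models over a Kripke model K.  The family L_w is given
-- as a total function W → Theory; only its values on W^⊏ (worlds with a
-- predecessor) are ever used or constrained.

module _ (K : Kripke) (L : Kripke.W K → Theory) where
  open Kripke K

  HasPred : W → Set
  HasPred w = ∃ λ v → v ⊏ w

  _,_⊩_ : W → Formula → Set
  _,_⊩_ w (atom p) = V w p
  _,_⊩_ w ⊥'       = ⊥
  _,_⊩_ w (A ⇒ B)  = _,_⊩_ w A → _,_⊩_ w B
  _,_⊩_ w (□ A)    = ∀ u → w ⊏ u → L u ⊢ A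

  _,_⊩⁺_ : W → Formula → Set
  _,_⊩⁺_ w A = ∃ λ u → u ⊏ w × (∀ v → TransClosure _⊏_ u v → _,_⊩_ v A)

  IsProvabilityModel : Set
  IsProvabilityModel =
    (∀ w → HasPred w → Classical (L w)) ×
    (∀ w → HasPred w → ∀ A → PurelyModal A → _,_⊩⁺_ w A → L w ⊢ A)

  HasNecessitation : Set
  HasNecessitation = ∀ w → HasPred w → HasNecRule (L w)

  Agrees : Set
  Agrees = ∀ A w → (_,_⊨_ K w A ⇔ _,_⊩_ w A)

-- Let every world prove exactly what it forces in K (and, when ⊏ is
-- transitive, what it forces together with its □-version, which makes the
-- theory closed under necessitation). Then L u ⊢ A and K, u ⊨ A coincide
-- on all successors, so the box clauses of ⊨ and ⊩ agree and by induction
-- all formulas do. Such theories contain every tautology, since a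
-- tautology is true under the Boolean assignment a world induces on atoms
-- and boxed formulas; and modal completeness holds for every formula,
-- because w ⊩⁺ A gives A at w and at all successors of w.
module Submission where

open import Defs
open import Data.Product using (Σ; _×_; _,_; proj₁)
open import Level using (0ℓ)
open import Axiom.ExcludedMiddle using (ExcludedMiddle)
open import Relation.Binary.Definitions using (Transitive)
open import Data.List using (List; []; _∷_)
open import Data.List.Relation.Unary.All using (All; []; _∷_)
open import Relation.Nullary.Decidable using (does; proof)
open import Relation.Nullary.Reflects using (Reflects; of; invert; _→-reflects_)
open import Relation.Binary.PropositionalEquality using (subst)
open import Relation.Binary.Construct.Closure.Transitive using ([_]; _∷_)
open import Function.Bundles using (_⇔_; mk⇔; Equivalence)

data ModusPonens : List Formula → Formula → Set where
  mp : ∀ A B → ModusPonens (A ∷ (A ⇒ B) ∷ []) B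

data ModusPonensNec : List Formula → Formula → Set where
  mp  : ∀ A B → ModusPonensNec (A ∷ (A ⇒ B) ∷ []) B
  nec : ∀ A → ModusPonensNec (A ∷ []) (□ A)

module _ {T : Theory} (P : Formula → Set)
         (axioms : ∀ {A} → Theory.Ax T A → P A)
         (rules : ∀ {ps A} → Theory.Rule T ps A → All P ps → P A) where

  ⊢-closed : ∀ {A} → T ⊢ A → P A
  ⊢-closed-All : ∀ {ps} → All (T ⊢_) ps → All P ps

  ⊢-closed (ax a) = axioms a
  ⊢-closed (rule r ds) = rules r (⊢-closed-All ds)

  ⊢-closed-All [] = []
  ⊢-closed-All (d ∷ ds) = ⊢-closed d ∷ ⊢-closed-All ds

module _ (K : Kripke) (L : Kripke.W K → Theory) where

  agrees-from-□ : (∀ A w → (K , w ⊨ □ A) ⇔ _,_⊩_ K L w (□ A)) → Agrees K L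
  agrees-from-□ agree-□ (atom p) w = mk⇔ (λ v → v) (λ v → v)
  agrees-from-□ agree-□ ⊥'       w = mk⇔ (λ ()) (λ ())
  agrees-from-□ agree-□ (A ⇒ B)  w = mk⇔
    (λ h a → Equivalence.to   (ih B) (h (Equivalence.from (ih A) a)))
    (λ h a → Equivalence.from (ih B) (h (Equivalence.to   (ih A) a)))
    where
    ih : ∀ C → (K , w ⊨ C) ⇔ _,_⊩_ K L w C
    ih C = agrees-from-□ agree-□ C w
  agrees-from-□ agree-□ (□ A)    w = agree-□ A w

  ⊩⁺⇒⊨∧⊨□ : Agrees K L → ∀ {w} A → _,_⊩⁺_ K L w A → (K , w ⊨ A) × (K , w ⊨ □ A)
  ⊩⁺⇒⊨∧⊨□ agrees A (u , u⊏w , h) =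
      Equivalence.from (agrees A _) (h _ [ u⊏w ])
    , λ v w⊏v → Equivalence.from (agrees A v) (h v (u⊏w ∷ [ w⊏v ]))

module _ (em : ExcludedMiddle 0ℓ) (K : Kripke) where
  open Kripke K

  evalB-reflects-⊨ : ∀ w A →
    Reflects (K , w ⊨ A) (evalB (λ p → does (em {V w p})) (λ B → does (em {K , w ⊨ □ B})) A)
  evalB-reflects-⊨ w (atom p) = proof em
  evalB-reflects-⊨ w ⊥'       = of (λ ())
  evalB-reflects-⊨ w (A ⇒ B)  = evalB-reflects-⊨ w A →-reflects evalB-reflects-⊨ w B
  evalB-reflects-⊨ w (□ B)    = proof em

  tautology-valid : ∀ w A → Tautology A → K , w ⊨ A
  tautology-valid w A taut = invert (subst (Reflects _) (taut _ _) (evalB-reflects-⊨ w A))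

  truthTheory : W → Theory
  truthTheory u = record { Ax = K , u ⊨_ ; Rule = ModusPonens }

  truthTheory-⊢⇔⊨ : ∀ u A → truthTheory u ⊢ A ⇔ K , u ⊨ A
  truthTheory-⊢⇔⊨ u A = mk⇔ (⊢-closed (K , u ⊨_) (λ a → a) modusPonens) ax
    where
    modusPonens : ∀ {ps B} → ModusPonens ps B → All (K , u ⊨_) ps → K , u ⊨ B
    modusPonens (mp _ _) (a ∷ a⇒b ∷ []) = a⇒b a

  truthTheory-agrees : Agrees K truthTheory
  truthTheory-agrees = agrees-from-□ K truthTheory λ A w → mk⇔
    (λ h u w⊏u → Equivalence.from (truthTheory-⊢⇔⊨ u A) (h u w⊏u))
    (λ h u w⊏u → Equivalence.to (truthTheory-⊢⇔⊨ u A) (h u w⊏u))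

  -- Completeness is shown for all formulas.
  truthTheory-isProvabilityModel : IsProvabilityModel K truthTheory
  truthTheory-isProvabilityModel =
      (λ w _ → mp , λ A taut → ax (tautology-valid w A taut))
    , λ w _ A _ w⊩⁺A → ax (proj₁ (⊩⁺⇒⊨∧⊨□ K truthTheory truthTheory-agrees A w⊩⁺A))

  module _ (trans : Transitive _⊏_) where

    HereditaryTruth : W → Formula → Set
    HereditaryTruth u A = (K , u ⊨ A) × (K , u ⊨ □ A)

    hereditaryTheory : W → Theory
    hereditaryTheory u = record { Ax = HereditaryTruth u ; Rule = ModusPonensNec }

    hereditaryTheory-⊢⇔ : ∀ u A → hereditaryTheory u ⊢ A ⇔ HereditaryTruth u A
    hereditaryTheory-⊢⇔ u A = mk⇔ (⊢-closed (HereditaryTruth u) (λ a → a) closed) ax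
      where
      closed : ∀ {ps B} → ModusPonensNec ps B → All (HereditaryTruth u) ps → HereditaryTruth u B
      closed (mp _ _) ((a , □a) ∷ (a⇒b , □[a⇒b]) ∷ []) =
        a⇒b a , λ v u⊏v → □[a⇒b] v u⊏v (□a v u⊏v)
      closed (nec _) ((_ , □a) ∷ []) = □a , λ v u⊏v t v⊏t → □a t (trans u⊏v v⊏t)

    hereditaryTheory-agrees : Agrees K hereditaryTheory
    hereditaryTheory-agrees = agrees-from-□ K hereditaryTheory λ A w → mk⇔
      (λ h u w⊏u → ax (h u w⊏u , λ v u⊏v → h v (trans w⊏u u⊏v)))
      (λ h u w⊏u → proj₁ (Equivalence.to (hereditaryTheory-⊢⇔ u A) (h u w⊏u)))

    hereditaryTheory-isProvabilityModel : IsProvabilityModel K hereditaryTheory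
    hereditaryTheory-isProvabilityModel =
        (λ w _ → mp , λ A taut → ax (tautology-valid w A taut , λ v _ → tautology-valid v A taut))
      , λ w _ A _ w⊩⁺A → ax (⊩⁺⇒⊨∧⊨□ K hereditaryTheory hereditaryTheory-agrees A w⊩⁺A)

    hereditaryTheory-hasNecessitation : HasNecessitation K hereditaryTheory
    hereditaryTheory-hasNecessitation _ _ = nec

lemma3p5 : ExcludedMiddle 0ℓ → (K : Kripke) →
    (Σ (Kripke.W K → Theory) λ L → IsProvabilityModel K L × Agrees K L) ×
    (Transitive (Kripke._⊏_ K) →
      Σ (Kripke.W K → Theory) λ L →
        IsProvabilityModel K L × Agrees K L × HasNecessitation K L)
lemma3p5 em K =
    (truthTheory em K , truthTheory-isProvabilityModel em K , truthTheory-agrees em K)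
  , λ trans →
      hereditaryTheory em K trans
    , hereditaryTheory-isProvabilityModel em K trans
    , hereditaryTheory-agrees em K trans
    , hereditaryTheory-hasNecessitation em K trans
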